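{- Let $T$ be a CNAT. Suppose that $T$ has an internal dot one of whose two children is a leaf and the other of which is an internal dot. Then $T$ has at least two interacting leaves.
   Context: A non-ambiguous tree (NAT) is a filling of a rectangular grid in which each cell is dotted or not, such that: the top-left cell is dotted (the root); every dotted cell other than the root has either a dotted cell above it in the same column or a dotted cell to its left in the same row, but not both; and every row and every column contains at least one dotted cell. Each non-root dot has a parent: the nearest dot above it in its column, or the nearest dot to its left in its row. A complete non-ambiguous tree (CNAT) is a NAT in which every dot either has both a dot below it in its column and a dot to its right in its row (an internal dot), or neither (a leaf). Rows are labelled from top to bottom and columns from left to right; $r(d)$ and $c(d)$ denote the row and column of a dot $d$. A leaf is a left leaf if it lies in the same column as its parent, and a right leaf if it lies in the same row as its parent. Two left leaves $l_1,l_2$ with parents $p_1,p_2$ are interacting if $r(p_1)<r(l_2)<r(l_1)$ or $r(p_2)<r(l_1)<r(l_2)$; two right leaves are interacting if $c(p_1)<c(l_2)<c(l_1)$ or $c(p_2)<c(l_1)<c(l_2)$. "$T$ has two interacting leaves" means there is a pair of left leaves or a pair of right leaves that are interacting. -}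

module Defs where

open import Data.Nat using (ℕ)
open import Data.Fin using (Fin; toℕ; _<_)
open import Data.Bool using (Bool; true)
open import Data.Product using (Σ; ∃; _×_; _,_)
open import Data.Sum using (_⊎_)
open import Relation.Nullary using (¬_)
open import Relation.Binary.PropositionalEquality using (_≡_)

-- A filling of an m × n grid: rows Fin m (top to bottom), columns Fin n
-- (left to right); a cell (i , j) is dotted iff G i j ≡ true.
Grid : ℕ → ℕ → Set
Grid m n = Fin m → Fin n → Bool

module _ {m n : ℕ} (G : Grid m n) where

  Dot : Fin m → Fin n → Set
  Dot i j = G i j ≡ true

  IsRoot : Fin m → Fin n → Set
  IsRoot i j = (toℕ i ≡ 0) × (toℕ j ≡ 0)

  DotAbove : Fin m → Fin n → Set
  DotAbove i j = Σ (Fin m) λ i' → (i' < i) × Dot i' j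

  DotLeft : Fin m → Fin n → Set
  DotLeft i j = Σ (Fin n) λ j' → (j' < j) × Dot i j'

  DotBelow : Fin m → Fin n → Set
  DotBelow i j = Σ (Fin m) λ i' → (i < i') × Dot i' j

  DotRight : Fin m → Fin n → Set
  DotRight i j = Σ (Fin n) λ j' → (j < j') × Dot i j'

  record IsNAT : Set where
    field
      root-dotted : (z : Fin m) → (w : Fin n) → IsRoot z w → Dot z w
      non-root    : ∀ i j → Dot i j → ¬ IsRoot i j →
                    (DotAbove i j × ¬ DotLeft i j) ⊎ (¬ DotAbove i j × DotLeft i j)
      rows-nonempty : ∀ i → Σ (Fin n) λ j → Dot i j
      cols-nonempty : ∀ j → Σ (Fin m) λ i → Dot i j

  ParentAbove : Fin m → Fin n → Fin m → Set
  ParentAbove i j i' = Dot i j × (i' < i) × Dot i' j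
                       × (∀ k → i' < k → k < i → ¬ Dot k j)

  ParentLeft : Fin m → Fin n → Fin n → Set
  ParentLeft i j j' = Dot i j × (j' < j) × Dot i j'
                      × (∀ k → j' < k → k < j → ¬ Dot i k)

  IsParent : (pi : Fin m) (pj : Fin n) (i : Fin m) (j : Fin n) → Set
  IsParent pi pj i j = (pj ≡ j × ParentAbove i j pi) ⊎ (pi ≡ i × ParentLeft i j pj)

  Internal : Fin m → Fin n → Set
  Internal i j = Dot i j × DotBelow i j × DotRight i j

  Leaf : Fin m → Fin n → Set
  Leaf i j = Dot i j × ¬ DotBelow i j × ¬ DotRight i j

  record IsCNAT : Set where
    field
      nat : IsNAT
      complete : ∀ i j → Dot i j → Internal i j ⊎ Leaf i j

  LeftLeaf : (i : Fin m) (j : Fin n) (pi : Fin m) → Set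
  LeftLeaf i j pi = Leaf i j × ParentAbove i j pi

  RightLeaf : (i : Fin m) (j : Fin n) (pj : Fin n) → Set
  RightLeaf i j pj = Leaf i j × ParentLeft i j pj

  HasInteractingLeftLeaves : Set
  HasInteractingLeftLeaves =
    Σ (Fin m) λ r₁ → Σ (Fin n) λ c₁ → Σ (Fin m) λ p₁ →
    Σ (Fin m) λ r₂ → Σ (Fin n) λ c₂ → Σ (Fin m) λ p₂ →
      LeftLeaf r₁ c₁ p₁ × LeftLeaf r₂ c₂ p₂ ×
      (((p₁ < r₂) × (r₂ < r₁)) ⊎ ((p₂ < r₁) × (r₁ < r₂)))

  HasInteractingRightLeaves : Set
  HasInteractingRightLeaves =
    Σ (Fin m) λ r₁ → Σ (Fin n) λ c₁ → Σ (Fin n) λ p₁ →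
    Σ (Fin m) λ r₂ → Σ (Fin n) λ c₂ → Σ (Fin n) λ p₂ →
      RightLeaf r₁ c₁ p₁ × RightLeaf r₂ c₂ p₂ ×
      (((p₁ < c₂) × (c₂ < c₁)) ⊎ ((p₂ < c₁) × (c₁ < c₂)))

  HasTwoInteractingLeaves : Set
  HasTwoInteractingLeaves = HasInteractingLeftLeaves ⊎ HasInteractingRightLeaves

  HasLeafAndInternalChildren : Set
  HasLeafAndInternalChildren =
    Σ (Fin m) λ i → Σ (Fin n) λ j → Internal i j ×
    (Σ (Fin m) λ a₁ → Σ (Fin n) λ b₁ → Σ (Fin m) λ a₂ → Σ (Fin n) λ b₂ →
       IsParent i j a₁ b₁ × IsParent i j a₂ b₂ × Leaf a₁ b₁ × Internal a₂ b₂)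

-- Transposing the grid swaps left and right leaves, so we may assume that the
-- internal dot p has a left leaf l below it and an internal child to its right.
-- From an internal dot (q, c) with r(p) ≤ q < r(l) and c to the right of l's
-- column, go to the last dot of row q: it is a right leaf whose
-- parent (q, f) also has a child (s, f) below it. If (s, f) is a leaf, it is a
-- left leaf interacting with l, since q < r(l) < s or p < s < r(l). Otherwise,
-- if s < r(l), repeat from (s, f); if s > r(l), then (q, f) has a right leaf and
-- an internal child below, which is the transposed situation, so repeat in the
-- transposed grid from (f, s). The coordinate sum of the current internal dot
-- increases at every step, so the process stops.

module Submission where

open import Data.Nat as ℕ using (ℕ; zero; suc; _+_)
import Data.Nat.Properties as ℕ
open import Data.Fin using (Fin; toℕ; _<_; _≤_; _>_)
open import Data.Fin.Properties using (any?; _<?_; <-cmp; toℕ<n)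
open import Data.Fin.Induction using (<-wellFounded; >-wellFounded)
open import Data.Bool using (true)
open import Data.Bool.Properties using () renaming (_≟_ to _≟ᵇ_)
open import Data.Product using (Σ; _×_; _,_)
open import Data.Sum using (_⊎_; inj₁; inj₂; map)
open import Data.Empty using (⊥-elim)
open import Induction.WellFounded using (Acc; acc)
open import Relation.Nullary using (¬_; Dec; yes; no)
open import Relation.Nullary.Decidable using (_×-dec_)
open import Relation.Binary.Definitions using (tri<; tri≈; tri>)
open import Relation.Binary.PropositionalEquality using (_≡_; refl; subst; subst₂; cong)
open import Defs

module _ {k : ℕ} where

  Least Greatest : (Fin k → Set) → Set
  Least P = Σ (Fin k) λ s → P s × (∀ t → t < s → ¬ P t)
  Greatest P = Σ (Fin k) λ s → P s × (∀ t → s < t → ¬ P t)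

  module _ {P : Fin k → Set} (P? : ∀ t → Dec (P t)) where

    least : ∀ {w} → P w → Least P
    least {w} = go (<-wellFounded w)
      where
        go : ∀ {w} → Acc _<_ w → P w → Least P
        go {w} (acc smaller) pw with any? (λ t → (t <? w) ×-dec P? t)
        ... | yes (t , t<w , pt) = go (smaller t<w) pt
        ... | no none = w , pw , λ t t<w pt → none (t , t<w , pt)

    greatest : ∀ {w} → P w → Greatest P
    greatest {w} = go (>-wellFounded w)
      where
        go : ∀ {w} → Acc _>_ w → P w → Greatest P
        go {w} (acc larger) pw with any? (λ t → (w <? t) ×-dec P? t)
        ... | yes (t , w<t , pt) = go (larger w<t) pt
        ... | no none = w , pw , λ t w<t pt → none (t , w<t , pt)

_ᵀ : ∀ {m n} → Grid m n → Grid n m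
(G ᵀ) i j = G j i

module _ {m n : ℕ} (G : Grid m n) where

  dot? : ∀ i j → Dec (Dot G i j)
  dot? i j = G i j ≟ᵇ true

  leafᵀ : ∀ {i j} → Leaf G i j → Leaf (G ᵀ) j i
  leafᵀ (dot , noBelow , noRight) = dot , noRight , noBelow

  internalᵀ : ∀ {i j} → Internal G i j → Internal (G ᵀ) j i
  internalᵀ (dot , below , right) = dot , right , below

  rightLeafᵀ : ∀ {i j j'} → RightLeaf G i j j' → LeftLeaf (G ᵀ) j i j'
  rightLeafᵀ (leaf , parent) = leafᵀ leaf , parent

  cnatᵀ : IsCNAT G → IsCNAT (G ᵀ)
  cnatᵀ cnat = record
    { nat = record
      { root-dotted = λ i j (i≡0 , j≡0) → root-dotted j i (j≡0 , i≡0)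
      ; non-root = λ i j dot notRoot →
          swap (non-root j i dot λ (j≡0 , i≡0) → notRoot (i≡0 , j≡0))
      ; rows-nonempty = cols-nonempty
      ; cols-nonempty = rows-nonempty
      }
    ; complete = λ i j dot → map internalᵀ leafᵀ (IsCNAT.complete cnat j i dot)
    }
    where
      open IsNAT (IsCNAT.nat cnat)
      swap : ∀ {A B : Set} → (A × ¬ B) ⊎ (¬ A × B) → (B × ¬ A) ⊎ (¬ B × A)
      swap (inj₁ (a , ¬b)) = inj₂ (¬b , a)
      swap (inj₂ (¬a , b)) = inj₁ (b , ¬a)

module _ {m n : ℕ} (G : Grid m n) where

  interactingᵀ : HasTwoInteractingLeaves (G ᵀ) → HasTwoInteractingLeaves G
  interactingᵀ (inj₁ (r₁ , c₁ , p₁ , r₂ , c₂ , p₂ , (l₁ , pa₁) , (l₂ , pa₂) , order)) =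
    inj₂ (c₁ , r₁ , p₁ , c₂ , r₂ , p₂ ,
          (leafᵀ (G ᵀ) l₁ , pa₁) , (leafᵀ (G ᵀ) l₂ , pa₂) , order)
  interactingᵀ (inj₂ (r₁ , c₁ , p₁ , r₂ , c₂ , p₂ , (l₁ , pa₁) , (l₂ , pa₂) , order)) =
    inj₁ (c₁ , r₁ , p₁ , c₂ , r₂ , p₂ ,
          (leafᵀ (G ᵀ) l₁ , pa₁) , (leafᵀ (G ᵀ) l₂ , pa₂) , order)

  leaf⇒¬internal : ∀ {i j} → Leaf G i j → ¬ Internal G i j
  leaf⇒¬internal (_ , noBelow , _) (_ , below , _) = noBelow below

  parentAbove-unique : ∀ {i a a'} {j} → ParentAbove G a j i → ParentAbove G a' j i → a ≡ a'
  parentAbove-unique {a = a} {a'} (dotA , i<a , _ , gapA) (dotA' , i<a' , _ , gapA') with <-cmp a a'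
  ... | tri< a<a' _ _ = ⊥-elim (gapA' a i<a a<a' dotA)
  ... | tri≈ _ a≡a' _ = a≡a'
  ... | tri> _ _ a'<a = ⊥-elim (gapA a' i<a' a'<a dotA')

  ¬leafAndInternalBelow : ∀ {i a a' j} → ParentAbove G a j i → ParentAbove G a' j i →
                          Leaf G a j → ¬ Internal G a' j
  ¬leafAndInternalBelow below below' leaf with parentAbove-unique below below'
  ... | refl = leaf⇒¬internal leaf

  rightmostDot : ∀ {i j} → DotRight G i j → Σ (Fin n) λ e → j < e × Dot G i e × ¬ DotRight G i e
  rightmostDot {i} {j} (c , j<c , dotC) with greatest (dot? G i) dotC
  ... | e , dotE , last = e , ℕ.<-≤-trans j<c (ℕ.≮⇒≥ λ e<c → last c e<c dotC) , dotE ,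
                          λ (t , e<t , dotT) → last t e<t dotT

  nearestLeft : ∀ {i j j'} → Dot G i j → j' < j → Dot G i j' →
                Σ (Fin n) λ f → j' ≤ f × ParentLeft G i j f
  nearestLeft {i} {j} {j'} dotJ j'<j dotJ' with greatest (λ t → (t <? j) ×-dec dot? G i t) (j'<j , dotJ')
  ... | f , (f<j , dotF) , last = f , ℕ.≮⇒≥ (λ f<j' → last j' f<j' (j'<j , dotJ')) ,
                                  (dotJ , f<j , dotF , λ k f<k k<j dotK → last k f<k (k<j , dotK))

  nearestBelow : ∀ {i j} → Dot G i j → DotBelow G i j → Σ (Fin m) λ s → ParentAbove G s j i
  nearestBelow {i} {j} dotIJ (s , i<s , dotS) with least (λ t → (i <? t) ×-dec dot? G t j) (i<s , dotS)
  ... | s' , (i<s' , dotS') , first =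
    s' , (dotS' , i<s' , dotIJ , λ k i<k k<s' dotK → first k k<s' (i<k , dotK))

  record RightLeafFork (q : Fin m) (c : Fin n) : Set where
    constructor fork
    field
      f e : Fin n
      s : Fin m
      c≤f : c ≤ f
      rightLeaf : RightLeaf G q e f
      childBelow : ParentAbove G s f q

  module _ (cnat : IsCNAT G) where

    dotRight⇒internal : ∀ {i j} → Dot G i j → DotRight G i j → Internal G i j
    dotRight⇒internal dot right with IsCNAT.complete cnat _ _ dot
    ... | inj₁ internal = internal
    ... | inj₂ (_ , _ , noRight) = ⊥-elim (noRight right)

    noDotRight⇒leaf : ∀ {i j} → Dot G i j → ¬ DotRight G i j → Leaf G i j
    noDotRight⇒leaf dot noRight with IsCNAT.complete cnat _ _ dot
    ... | inj₁ (_ , _ , right) = ⊥-elim (noRight right)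
    ... | inj₂ leaf = leaf

    rightLeafFork : ∀ {q c} → Internal G q c → RightLeafFork q c
    rightLeafFork (dotQC , _ , right) with rightmostDot right
    ... | e , c<e , dotE , lastE with nearestLeft dotE c<e dotQC
    ... | f , c≤f , parentE@(_ , f<e , dotF , _) with dotRight⇒internal dotF (e , f<e , dotE)
    ... | _ , below , _ with nearestBelow dotF below
    ... | s , childS = fork f e s c≤f (noDotRight⇒leaf dotE lastE , parentE) childS

fuel-decreases : ∀ F {N q c s f} →
                 N ℕ.≤ suc F + (q + c) → q ℕ.< s → c ℕ.≤ f → N ℕ.≤ F + (s + f)
fuel-decreases F {q = q} {c} {s} {f} bound q<s c≤f =
  ℕ.≤-trans bound
    (subst (ℕ._≤ F + (s + f)) (ℕ.+-suc F (q + c)) (ℕ.+-monoʳ-≤ F (ℕ.+-mono-≤ q<s c≤f)))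

interactingFrom : (fuel : ℕ) {m n : ℕ} (G : Grid m n) → IsCNAT G →
  ∀ {i a q : Fin m} {j c : Fin n} → LeftLeaf G a j i → Internal G q c →
  i ≤ q → q < a → j < c → m + n ℕ.≤ fuel + (toℕ q + toℕ c) → HasTwoInteractingLeaves G
interactingFrom zero _ _ {q = q} {c = c} _ _ _ _ _ bound =
  ⊥-elim (ℕ.<⇒≱ (ℕ.+-mono-< (toℕ<n q) (toℕ<n c)) bound)
interactingFrom (suc fuel) {m} {n} G cnat {i} {a} {q} {j} {c}
                leftLeafA@((_ , _ , noRightA) , _) intQC i≤q q<a j<c bound
  with rightLeafFork G cnat intQC
... | fork f e s c≤f rightLeafE@(_ , _ , f<e , _) childS@(dotS , q<s , _)
  with <-cmp s a | IsCNAT.complete cnat s f dotS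
... | tri≈ _ refl _ | _ = ⊥-elim (noRightA (f , ℕ.<-≤-trans j<c c≤f , dotS))
... | tri< s<a _ _ | inj₂ leafS =
  inj₁ (a , j , i , s , f , q , leftLeafA , (leafS , childS) , inj₁ (ℕ.≤-<-trans i≤q q<s , s<a))
... | tri> _ _ a<s | inj₂ leafS =
  inj₁ (a , j , i , s , f , q , leftLeafA , (leafS , childS) , inj₂ (q<a , a<s))
... | tri< s<a _ _ | inj₁ intS =
  interactingFrom fuel G cnat leftLeafA intS
    (ℕ.≤-trans i≤q (ℕ.<⇒≤ q<s)) s<a (ℕ.<-≤-trans j<c c≤f) (fuel-decreases fuel bound q<s c≤f)
... | tri> _ _ a<s | inj₁ intS =
  interactingᵀ G (interactingFrom fuel (G ᵀ) (cnatᵀ G cnat)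
    (rightLeafᵀ G rightLeafE) (internalᵀ G intS) ℕ.≤-refl f<e q<s
    (subst₂ ℕ._≤_ (ℕ.+-comm m n) (cong (fuel +_) (ℕ.+-comm (toℕ s) (toℕ f)))
            (fuel-decreases fuel bound q<s c≤f)))

module _ {m n : ℕ} (G : Grid m n) where

  interactingFromSiblings : IsCNAT G → ∀ {i a j b} → LeftLeaf G a j i → ParentLeft G i b j →
                            Internal G i b → HasTwoInteractingLeaves G
  interactingFromSiblings cnat leftLeaf@(_ , _ , i<a , _) (_ , j<b , _) internal =
    interactingFrom (m + n) G cnat leftLeaf internal ℕ.≤-refl i<a j<b (ℕ.m≤m+n (m + n) _)

lemma2 : (m n : ℕ) (G : Grid m n) → IsCNAT G →
    HasLeafAndInternalChildren G → HasTwoInteractingLeaves G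
lemma2 m n G cnat (_ , _ , _ , _ , _ , _ , _ , inj₁ (refl , below) , inj₁ (refl , below') , leaf , internal) =
  ⊥-elim (¬leafAndInternalBelow G below below' leaf internal)
lemma2 m n G cnat (_ , _ , _ , _ , _ , _ , _ , inj₂ (refl , right) , inj₂ (refl , right') , leaf , internal) =
  ⊥-elim (¬leafAndInternalBelow (G ᵀ) right right' (leafᵀ G leaf) (internalᵀ G internal))
lemma2 m n G cnat (_ , _ , _ , _ , _ , _ , _ , inj₁ (refl , below) , inj₂ (refl , right) , leaf , internal) =
  interactingFromSiblings G cnat (leaf , below) right internal
lemma2 m n G cnat (_ , _ , _ , _ , _ , _ , _ , inj₂ (refl , right) , inj₁ (refl , below) , leaf , internal) =
  interactingᵀ G
    (interactingFromSiblings (G ᵀ) (cnatᵀ G cnat) (leafᵀ G leaf , right) below (internalᵀ G internal))
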